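{- For a bipartite graph $B=(X,Y,E)$ the following are equivalent: (i) $B$ is an ACB graph; (ii) $B$ has no induced subgraph isomorphic to $3K_2$, $C_6$ or $C_8$; (iii) $B$ is chordal bipartite and has no induced $3K_2$; (iv) $split_X(B)$ and $\overline{split_X(B)}$ are both strongly chordal.
   Context: Bipartite graph $B=(X,Y,E)$ with color classes $X,Y$. Chordal bipartite: no induced chordless cycle $C_{2k}$ with $k\ge3$. Mirror $mir(B)$: same color classes, $xy$ ($x\in X$, $y\in Y$) an edge iff not an edge of $B$. ACB: $B$ and $mir(B)$ chordal bipartite. $3K_2$: disjoint union of three edges. $split_X(B)$: graph obtained from $B$ by making $X$ a clique; $\overline{H}$ is the complement of a graph $H$. Strongly chordal: chordal (no induced $C_k$, $k\ge 4$) and no induced $k$-sun $S_k$, $k\ge3$ (clique $q_0,\dots,q_{k-1}$, stable set $s_0,\dots,s_{k-1}$, $s_i$ adjacent exactly to $q_i,q_{i+1}$, indices mod $k$). -}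

module Defs where

open import Data.Nat using (ℕ; zero; suc; _≤_; _*_; _≡ᵇ_; _/_)
open import Data.Fin using (Fin; toℕ)
open import Data.Bool using (Bool; true; false; not; _∧_; _∨_)
open import Data.Sum using (_⊎_; inj₁; inj₂)
open import Data.Product using (_×_; Σ; ∃-syntax)
open import Relation.Binary.PropositionalEquality using (_≡_; _≢_)
open import Relation.Nullary using (¬_)
open import Function.Definitions using (Injective)

-- A (finite, simple) graph is given by a vertex type V and a Bool-valued
-- adjacency relation; only its values on pairs of distinct vertices matter
-- (all notions below only inspect adjacency between distinct vertices).
Adj : Set → Set
Adj V = V → V → Bool

HasInduced : {W V : Set} → Adj W → Adj V → Set
HasInduced {W} {V} hadj adj =
  Σ (W → V) λ f → Injective _≡_ _≡_ f ×
    (∀ a b → a ≢ b → adj (f a) (f b) ≡ hadj a b)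

complement : {V : Set} → Adj V → Adj V
complement adj u v = not (adj u v)

isSucc : ℕ → ℕ → ℕ → Bool
isSucc k a b = (suc a ≡ᵇ b) ∨ ((b ≡ᵇ 0) ∧ (suc a ≡ᵇ k))

cycleAdj : (k : ℕ) → Adj (Fin k)
cycleAdj k i j = isSucc k (toℕ i) (toℕ j) ∨ isSucc k (toℕ j) (toℕ i)

-- 3K₂: vertices 0..5, edges {0,1},{2,3},{4,5}.
threeK2 : Adj (Fin 6)
threeK2 i j = toℕ i / 2 ≡ᵇ toℕ j / 2

-- k-sun S_k: clique q_0..q_{k-1} (inj₁), stable set s_0..s_{k-1} (inj₂),
-- s_i adjacent exactly to q_i and q_{i+1} (indices mod k).
sunAdj : (k : ℕ) → Adj (Fin k ⊎ Fin k)
sunAdj k (inj₁ _) (inj₁ _) = true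
sunAdj k (inj₂ _) (inj₂ _) = false
sunAdj k (inj₁ j) (inj₂ i) = (toℕ i ≡ᵇ toℕ j) ∨ isSucc k (toℕ i) (toℕ j)
sunAdj k (inj₂ i) (inj₁ j) = (toℕ i ≡ᵇ toℕ j) ∨ isSucc k (toℕ i) (toℕ j)

Chordal : {V : Set} → Adj V → Set
Chordal adj = ∀ k → 4 ≤ k → ¬ HasInduced (cycleAdj k) adj

StronglyChordal : {V : Set} → Adj V → Set
StronglyChordal adj = Chordal adj × (∀ k → 3 ≤ k → ¬ HasInduced (sunAdj k) adj)

BipEdges : ℕ → ℕ → Set
BipEdges nX nY = Fin nX → Fin nY → Bool

bipGraph : {nX nY : ℕ} → BipEdges nX nY → Adj (Fin nX ⊎ Fin nY)
bipGraph E (inj₁ x) (inj₂ y) = E x y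
bipGraph E (inj₂ y) (inj₁ x) = E x y
bipGraph E (inj₁ _) (inj₁ _) = false
bipGraph E (inj₂ _) (inj₂ _) = false

splitX : {nX nY : ℕ} → BipEdges nX nY → Adj (Fin nX ⊎ Fin nY)
splitX E (inj₁ x) (inj₂ y) = E x y
splitX E (inj₂ y) (inj₁ x) = E x y
splitX E (inj₁ _) (inj₁ _) = true
splitX E (inj₂ _) (inj₂ _) = false

mirror : {nX nY : ℕ} → BipEdges nX nY → BipEdges nX nY
mirror E x y = not (E x y)

ChordalBipartite : {nX nY : ℕ} → BipEdges nX nY → Set
ChordalBipartite E = ∀ k → 3 ≤ k → ¬ HasInduced (cycleAdj (2 * k)) (bipGraph E)

ACB : {nX nY : ℕ} → BipEdges nX nY → Set
ACB E = ChordalBipartite E × ChordalBipartite (mirror E)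

module Submission where

-- Everything reduces to patterns in the biadjacency matrix E. Because the sides of an
-- embedded cycle alternate, and the two ends of each edge of an embedded 3K₂ lie on opposite
-- sides, an induced 3K₂, C₆ or C₈ of B is the same thing as an occurrence in E of the identity
-- matrix I₃ or of the biadjacency matrix of C₆ or C₈.  A k-sun of split_X(B) must put its clique
-- in X and its stable set in Y, so it is an occurrence of the biadjacency matrix of C_{2k}.
-- Mirroring complements the matrix: the complement of I₃ is the matrix of C₆, and the matrix of
-- C₈ is self-complementary up to permutation, so mir(B) has an induced C₆ or C₈ iff B has an
-- induced 3K₂ or C₈.  The complement of split_X(B) is again a split graph, built from the
-- transposed mirror.  Longer cycles and suns contain 3K₂, and split graphs are chordal.  So each
-- of (i)–(iv) says that none of I₃, C₆, C₈ occurs in E.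

open import Defs
open import Data.Bool using (Bool; true; false; not; _xor_; if_then_else_)
open import Data.Bool.Properties using (not-involutive; not-distribˡ-xor; not-distribʳ-xor)
  renaming (_≟_ to _≟ᵇ_)
open import Data.Empty using (⊥)
open import Data.Fin using (Fin; zero; suc; toℕ; inject₁; combine; remQuot; opposite)
open import Data.Fin.Patterns using (0F; 1F; 2F; 3F; 4F; 6F; 7F)
open import Data.Fin.Properties using (all?; any?; toℕ-inject₁; toℕ-↑ˡ; combine-injectiveʳ)
  renaming (_≟_ to _≟ᶠ_)
open import Data.Nat using (ℕ; zero; suc; _+_; _*_; _≤_; z≤n; s≤s; _≡ᵇ_)
open import Data.Nat.Properties
  using (1+n≢n; ≤-refl; ≤-trans; n≤1+n; m≤m+n; *-monoʳ-≤; m≤n⇒∃[o]m+o≡n)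
open import Data.Product using (_×_; _,_; proj₁; proj₂; ∃-syntax; Σ-syntax)
open import Data.Sum as Sum using (_⊎_; inj₁; inj₂; swap)
open import Data.Sum.Properties using (≡-dec; swap-involutive; inj₁-injective; inj₂-injective)
open import Data.Vec using ([]; _∷_; lookup)
open import Function using (_∘_; id)
open import Function.Bundles using (_⇔_; mk⇔)
open import Function.Definitions using (Injective)
open import Relation.Binary.Definitions using (DecidableEquality)
open import Relation.Binary.PropositionalEquality
open import Relation.Nullary using (Dec; ¬_; ¬?; _×-dec_; _⊎-dec_; contradiction)
open import Relation.Nullary.Decidable using (True; toWitness)

private
  variable
    n p q p′ q′ nX nY : ℕ
    U V W : Set

≡ᵇ-refl : ∀ n → (n ≡ᵇ n) ≡ true
≡ᵇ-refl zero    = refl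
≡ᵇ-refl (suc n) = ≡ᵇ-refl n

1+n≢ᵇn : ∀ n → (suc n ≡ᵇ n) ≡ false
1+n≢ᵇn zero    = refl
1+n≢ᵇn (suc n) = 1+n≢ᵇn n

2+n≢ᵇn : ∀ n → (suc (suc n) ≡ᵇ n) ≡ false
2+n≢ᵇn zero    = refl
2+n≢ᵇn (suc n) = 2+n≢ᵇn n

odd : ℕ → Bool
odd zero    = false
odd (suc n) = not (odd n)

inject₁≢suc : (i : Fin n) → inject₁ i ≢ suc i
inject₁≢suc i eq = 1+n≢n (sym (trans (sym (toℕ-inject₁ i)) (cong toℕ eq)))

swap-injective : Injective _≡_ _≡_ (swap {A = U} {B = W})
swap-injective {x = u} {y = v} eq =
  trans (sym (swap-involutive u)) (trans (cong swap eq) (swap-involutive v))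

IsInj₁ IsInj₂ : U ⊎ W → Set
IsInj₁ u = ∃[ a ] u ≡ inj₁ a
IsInj₂ u = ∃[ b ] u ≡ inj₂ b

isInj₁ : U ⊎ W → Bool
isInj₁ (inj₁ _) = true
isInj₁ (inj₂ _) = false

isInj₁-true : {u : U ⊎ W} → isInj₁ u ≡ true → IsInj₁ u
isInj₁-true {u = inj₁ a} _ = a , refl

isInj₁-false : {u : U ⊎ W} → isInj₁ u ≡ false → IsInj₂ u
isInj₁-false {u = inj₂ b} _ = b , refl

HasInduced-trans : {H : Adj U} {K : Adj W} {G : Adj V} →
  HasInduced H K → HasInduced K G → HasInduced H G
HasInduced-trans (f , f-inj , f-adj) (g , g-inj , g-adj) =
  g ∘ f , f-inj ∘ g-inj ,
  λ a b a≢b → trans (g-adj (f a) (f b) (a≢b ∘ f-inj)) (f-adj a b a≢b)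

InducedBy : (Fin n → W) → Adj (Fin n) → Adj W → Set
InducedBy ι H G = ∀ a b → a ≡ b ⊎ (ι a ≢ ι b × G (ι a) (ι b) ≡ H a b)

inducedBy? : DecidableEquality W → (ι : Fin n → W) (H : Adj (Fin n)) (G : Adj W) →
  Dec (InducedBy ι H G)
inducedBy? _≟_ ι H G =
  all? λ a → all? λ b → (a ≟ᶠ b) ⊎-dec (¬? (ι a ≟ ι b) ×-dec (G (ι a) (ι b) ≟ᵇ H a b))

InducedBy⇒HasInduced : {ι : Fin n → W} {H : Adj (Fin n)} {G : Adj W} →
  InducedBy ι H G → HasInduced H G
InducedBy⇒HasInduced {ι = ι} {H} {G} by = ι , injective , adjacency
  where
  injective : Injective _≡_ _≡_ ι
  injective {a} {b} ιa≡ιb with by a b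
  ... | inj₁ a≡b = a≡b
  ... | inj₂ (ιa≢ιb , _) = contradiction ιa≡ιb ιa≢ιb
  adjacency : ∀ a b → a ≢ b → G (ι a) (ι b) ≡ H a b
  adjacency a b a≢b with by a b
  ... | inj₁ a≡b = contradiction a≡b a≢b
  ... | inj₂ (_ , adj) = adj

induced-via : (_≟_ : DecidableEquality W) (H : Adj (Fin n)) (G : Adj W) (ι : Fin n → W) →
  {checked : True (inducedBy? _≟_ ι H G)} → HasInduced H G
induced-via _≟_ H G ι {checked = ok} =
  InducedBy⇒HasInduced {ι = ι} {H} {G} (toWitness {a? = inducedBy? _≟_ ι H G} ok)

-- Patterns in biadjacency matrices

transpose : BipEdges p q → BipEdges q p
transpose P j i = P i j

-- Rows and columns may repeat; for twin-free patterns they cannot (⊑-row-injective).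
record _⊑_ (P : BipEdges p q) (E : BipEdges nX nY) : Set where
  field
    row   : Fin p → Fin nX
    col   : Fin q → Fin nY
    entry : ∀ i j → E (row i) (col j) ≡ P i j

open _⊑_

⊑-trans : {P : BipEdges p q} {Q : BipEdges p′ q′} {E : BipEdges nX nY} →
  P ⊑ Q → Q ⊑ E → P ⊑ E
⊑-trans P⊑Q Q⊑E = record
  { row   = row Q⊑E ∘ row P⊑Q
  ; col   = col Q⊑E ∘ col P⊑Q
  ; entry = λ i j → trans (entry Q⊑E _ _) (entry P⊑Q i j)
  }

⊑-via : {P : BipEdges p q} {Q : BipEdges p′ q′} (σ : Fin p → Fin p′) (τ : Fin q → Fin q′) →
  {checked : True (all? λ i → all? λ j → Q (σ i) (τ j) ≟ᵇ P i j)} → P ⊑ Q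
⊑-via {P = P} {Q} σ τ {checked = ok} =
  record { row = σ ; col = τ
         ; entry = toWitness {a? = all? λ i → all? λ j → Q (σ i) (τ j) ≟ᵇ P i j} ok }

⊑-cong : {P P′ : BipEdges p q} {E : BipEdges nX nY} →
  (∀ i j → P i j ≡ P′ i j) → P ⊑ E → P′ ⊑ E
⊑-cong P≗P′ P⊑E = record
  { row = row P⊑E ; col = col P⊑E ; entry = λ i j → trans (entry P⊑E i j) (P≗P′ i j) }

⊑-transpose : {P : BipEdges p q} {E : BipEdges nX nY} → P ⊑ E → transpose P ⊑ transpose E
⊑-transpose P⊑E = record { row = col P⊑E ; col = row P⊑E ; entry = λ j i → entry P⊑E i j }

⊑-mirror : {P : BipEdges p q} {E : BipEdges nX nY} → P ⊑ E → mirror P ⊑ mirror E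
⊑-mirror P⊑E = record
  { row = row P⊑E ; col = col P⊑E ; entry = λ i j → cong not (entry P⊑E i j) }

⊑-of-mirror : {P : BipEdges p q} {E : BipEdges nX nY} → P ⊑ mirror E → mirror P ⊑ E
⊑-of-mirror P⊑E = record
  { row = row P⊑E ; col = col P⊑E
  ; entry = λ i j → trans (sym (not-involutive _)) (cong not (entry P⊑E i j)) }

mirrorᵀ : BipEdges p q → BipEdges q p
mirrorᵀ P = mirror (transpose P)

⊑-mirrorᵀ : {P : BipEdges p q} {E : BipEdges nX nY} → P ⊑ E → mirrorᵀ P ⊑ mirrorᵀ E
⊑-mirrorᵀ = ⊑-mirror ∘ ⊑-transpose

⊑-of-mirrorᵀ : {P : BipEdges p q} {E : BipEdges nX nY} → P ⊑ mirrorᵀ E → mirrorᵀ P ⊑ E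
⊑-of-mirrorᵀ = ⊑-transpose ∘ ⊑-of-mirror

DistinctRows : BipEdges p q → Set
DistinctRows P = ∀ i i′ → i ≡ i′ ⊎ ∃[ j ] P i j ≢ P i′ j

distinctRows? : (P : BipEdges p q) → Dec (DistinctRows P)
distinctRows? P =
  all? λ i → all? λ i′ → (i ≟ᶠ i′) ⊎-dec any? λ j → ¬? (P i j ≟ᵇ P i′ j)

TwinFree : BipEdges p q → Set
TwinFree P = DistinctRows P × DistinctRows (transpose P)

twinFree? : (P : BipEdges p q) → Dec (TwinFree P)
twinFree? P = distinctRows? P ×-dec distinctRows? (transpose P)

⊑-row-injective : {P : BipEdges p q} {E : BipEdges nX nY} →
  (P⊑E : P ⊑ E) → DistinctRows P → Injective _≡_ _≡_ (row P⊑E)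
⊑-row-injective {E = E} P⊑E distinct {i} {i′} same-row with distinct i i′
... | inj₁ i≡i′ = i≡i′
... | inj₂ (j , Pij≢Pi′j) = contradiction
  (trans (sym (entry P⊑E i j)) (trans (cong (λ x → E x (col P⊑E j)) same-row) (entry P⊑E i′ j)))
  Pij≢Pi′j

sides-injective : {P : BipEdges p q} {E : BipEdges nX nY} →
  (P⊑E : P ⊑ E) → TwinFree P → Injective _≡_ _≡_ (Sum.map (row P⊑E) (col P⊑E))
sides-injective P⊑E (rows , _) {inj₁ _} {inj₁ _} eq =
  cong inj₁ (⊑-row-injective P⊑E rows (inj₁-injective eq))
sides-injective P⊑E (_ , cols) {inj₂ _} {inj₂ _} eq =
  cong inj₂ (⊑-row-injective (⊑-transpose P⊑E) cols (inj₂-injective eq))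
sides-injective P⊑E _ {inj₁ _} {inj₂ _} ()
sides-injective P⊑E _ {inj₂ _} {inj₁ _} ()

bipGraph-⊑ : {P : BipEdges p q} {E : BipEdges nX nY} →
  P ⊑ E → {checked : True (twinFree? P)} → HasInduced (bipGraph P) (bipGraph E)
bipGraph-⊑ {P = P} {E} P⊑E {checked = ok} =
  Sum.map (row P⊑E) (col P⊑E) , sides-injective P⊑E (toWitness ok) , λ u v _ → adjacency u v
  where
  adjacency : ∀ u v →
    bipGraph E (Sum.map (row P⊑E) (col P⊑E) u) (Sum.map (row P⊑E) (col P⊑E) v) ≡ bipGraph P u v
  adjacency (inj₁ i) (inj₂ j) = entry P⊑E i j
  adjacency (inj₂ j) (inj₁ i) = entry P⊑E i j
  adjacency (inj₁ _) (inj₁ _) = refl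
  adjacency (inj₂ _) (inj₂ _) = refl

splitX-⊑ : {P : BipEdges p q} {E : BipEdges nX nY} →
  P ⊑ E → {checked : True (twinFree? P)} → HasInduced (splitX P) (splitX E)
splitX-⊑ {P = P} {E} P⊑E {checked = ok} =
  Sum.map (row P⊑E) (col P⊑E) , sides-injective P⊑E (toWitness ok) , λ u v _ → adjacency u v
  where
  adjacency : ∀ u v →
    splitX E (Sum.map (row P⊑E) (col P⊑E) u) (Sum.map (row P⊑E) (col P⊑E) v) ≡ splitX P u v
  adjacency (inj₁ i) (inj₂ j) = entry P⊑E i j
  adjacency (inj₂ j) (inj₁ i) = entry P⊑E i j
  adjacency (inj₁ _) (inj₁ _) = refl
  adjacency (inj₂ _) (inj₂ _) = refl

⊑-of-embedding : {H : Adj W} {G : Adj (Fin nX ⊎ Fin nY)} (H↪G : HasInduced H G)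
  (ρ : Fin p → W) (κ : Fin q → W) →
  (∀ i → IsInj₁ (proj₁ H↪G (ρ i))) → (∀ j → IsInj₂ (proj₁ H↪G (κ j))) →
  (λ i j → H (ρ i) (κ j)) ⊑ (λ x y → G (inj₁ x) (inj₂ y))
⊑-of-embedding {H = H} {G} (f , _ , f-adj) ρ κ in₁ in₂ =
  record { row = proj₁ ∘ in₁ ; col = proj₁ ∘ in₂ ; entry = entry′ }
  where
  entry′ : ∀ i j → G (inj₁ (proj₁ (in₁ i))) (inj₂ (proj₁ (in₂ j))) ≡ H (ρ i) (κ j)
  entry′ i j with in₁ i | in₂ j
  ... | x , fρi≡x | y , fκj≡y =
    trans (sym (cong₂ G fρi≡x fκj≡y)) (f-adj (ρ i) (κ j) ρi≢κj)
    where
    ρi≢κj : ρ i ≢ κ j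
    ρi≢κj ρi≡κj with trans (sym fρi≡x) (trans (cong f ρi≡κj) fκj≡y)
    ... | ()

matching : BipEdges 3 3
matching i j = toℕ i ≡ᵇ toℕ j

-- q_i ~ s_j iff j ∈ {i, i − 1} (mod k): the biadjacency matrix of the 2k-cycle q₀ s₀ q₁ s₁ …
cycleMatrix : ∀ k → BipEdges k k
cycleMatrix k i j = sunAdj k (inj₁ i) (inj₂ j)

-- Position 2t + b of a zigzag walk visits q_t if b = 0 and s_t if b = 1.
zigzag : ∀ {k} → Fin (k * 2) → Fin k ⊎ Fin k
zigzag i with remQuot 2 i
... | t , 0F = inj₁ t
... | t , 1F = inj₂ t

-- Relations between the forbidden patterns

cycleMatrix₃⊑mirror-matching : cycleMatrix 3 ⊑ mirror matching
cycleMatrix₃⊑mirror-matching = ⊑-via id (lookup (2F ∷ 0F ∷ 1F ∷ []))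

matching⊑mirror-cycleMatrix₃ : matching ⊑ mirror (cycleMatrix 3)
matching⊑mirror-cycleMatrix₃ = ⊑-via id (lookup (1F ∷ 2F ∷ 0F ∷ []))

cycleMatrix₄⊑mirror-cycleMatrix₄ : cycleMatrix 4 ⊑ mirror (cycleMatrix 4)
cycleMatrix₄⊑mirror-cycleMatrix₄ = ⊑-via id (lookup (2F ∷ 3F ∷ 0F ∷ 1F ∷ []))

cycleMatrix₃⊑mirrorᵀ-matching : cycleMatrix 3 ⊑ mirrorᵀ matching
cycleMatrix₃⊑mirrorᵀ-matching = ⊑-via id (lookup (2F ∷ 0F ∷ 1F ∷ []))

matching⊑mirrorᵀ-cycleMatrix₃ : matching ⊑ mirrorᵀ (cycleMatrix 3)
matching⊑mirrorᵀ-cycleMatrix₃ = ⊑-via id (lookup (2F ∷ 0F ∷ 1F ∷ []))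

cycleMatrix₄⊑mirrorᵀ-cycleMatrix₄ : cycleMatrix 4 ⊑ mirrorᵀ (cycleMatrix 4)
cycleMatrix₄⊑mirrorᵀ-cycleMatrix₄ = ⊑-via id (lookup (3F ∷ 0F ∷ 1F ∷ 2F ∷ []))

matching⊑cycleMatrix : ∀ m → matching ⊑ cycleMatrix (5 + m)
matching⊑cycleMatrix m = ⊑-via (lookup (0F ∷ 2F ∷ 3F ∷ [])) (lookup (0F ∷ 1F ∷ 3F ∷ []))

module _ {E : BipEdges nX nY} where

  bipGraph-edge-flips : ∀ {u v} → bipGraph E u v ≡ true → isInj₁ v ≡ not (isInj₁ u)
  bipGraph-edge-flips {inj₁ _} {inj₂ _} _ = refl
  bipGraph-edge-flips {inj₂ _} {inj₁ _} _ = refl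
  bipGraph-edge-flips {inj₁ _} {inj₁ _} ()
  bipGraph-edge-flips {inj₂ _} {inj₂ _} ()

  bipGraph-edge-sides : ∀ {u v} → bipGraph E u v ≡ true →
    (IsInj₁ u × IsInj₂ v) ⊎ (IsInj₂ u × IsInj₁ v)
  bipGraph-edge-sides {inj₁ x} {inj₂ y} _ = inj₁ ((x , refl) , (y , refl))
  bipGraph-edge-sides {inj₂ y} {inj₁ x} _ = inj₂ ((y , refl) , (x , refl))
  bipGraph-edge-sides {inj₁ _} {inj₁ _} ()
  bipGraph-edge-sides {inj₂ _} {inj₂ _} ()

threeK2-pairs : ∀ t (b : Fin 2) t′ (b′ : Fin 2) →
  threeK2 (combine t b) (combine t′ b′) ≡ matching t t′
threeK2-pairs = toWitness {a? = all? λ t → all? λ b → all? λ t′ → all? λ b′ →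
  threeK2 (combine t b) (combine t′ b′) ≟ᵇ matching t t′} _

3K₂⇒matching⊑ : {E : BipEdges nX nY} → HasInduced threeK2 (bipGraph E) → matching ⊑ E
3K₂⇒matching⊑ {E = E} K@(f , _ , f-adj) =
  ⊑-cong (λ t t′ → threeK2-pairs t _ t′ _)
    (⊑-of-embedding {H = threeK2} {G = bipGraph E} K
      (λ t → end t (proj₁ (x-end t))) (λ t → end t (proj₁ (y-end t)))
      (proj₂ ∘ x-end) (proj₂ ∘ y-end))
  where
  end : Fin 3 → Fin 2 → Fin 6
  end = combine
  crossing : ∀ t → (IsInj₁ (f (end t 0F)) × IsInj₂ (f (end t 1F))) ⊎
                   (IsInj₂ (f (end t 0F)) × IsInj₁ (f (end t 1F)))
  crossing t = bipGraph-edge-sides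
    (trans (f-adj (end t 0F) (end t 1F) ((λ ()) ∘ combine-injectiveʳ t 0F t 1F))
      (trans (threeK2-pairs t 0F t 1F) (≡ᵇ-refl (toℕ t))))
  x-end : ∀ t → Σ[ b ∈ Fin 2 ] IsInj₁ (f (end t b))
  x-end t with crossing t
  ... | inj₁ (in₁ , _) = 0F , in₁
  ... | inj₂ (_ , in₁) = 1F , in₁
  y-end : ∀ t → Σ[ b ∈ Fin 2 ] IsInj₂ (f (end t b))
  y-end t with crossing t
  ... | inj₁ (_ , in₂) = 1F , in₂
  ... | inj₂ (in₂ , _) = 0F , in₂

matching⊑⇒3K₂ : {E : BipEdges nX nY} → matching ⊑ E → HasInduced threeK2 (bipGraph E)
matching⊑⇒3K₂ {E = E} M = HasInduced-trans {G = bipGraph E}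
  (induced-via (≡-dec _≟ᶠ_ _≟ᶠ_) threeK2 (bipGraph matching) zigzag) (bipGraph-⊑ M)

odd-combine : ∀ {k} (t : Fin k) (b : Fin 2) → odd (toℕ (combine t b)) ≡ odd (toℕ b)
odd-combine {suc k} zero    b = cong odd (toℕ-↑ˡ b (k * 2))
odd-combine         (suc t) b = trans (not-involutive _) (odd-combine t b)

alternation : (c : Fin (suc n) → Bool) → (∀ i → c (suc i) ≡ not (c (inject₁ i))) →
  ∀ i → c i ≡ odd (toℕ i) xor c zero
alternation c step zero = refl
alternation {suc n} c step (suc i) = begin
  c (suc i)                      ≡⟨ alternation (c ∘ suc) (step ∘ suc) i ⟩
  odd (toℕ i) xor c 1F           ≡⟨ cong (odd (toℕ i) xor_) (step zero) ⟩
  odd (toℕ i) xor not (c zero)   ≡⟨ sym (not-distribʳ-xor (odd (toℕ i)) (c zero)) ⟩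
  not (odd (toℕ i) xor c zero)   ≡⟨ not-distribˡ-xor (odd (toℕ i)) (c zero) ⟩
  odd (suc (toℕ i)) xor c zero   ∎
  where open ≡-Reasoning

cycleAdj-step : (i : Fin n) → cycleAdj (suc n) (inject₁ i) (suc i) ≡ true
cycleAdj-step i rewrite toℕ-inject₁ i | ≡ᵇ-refl (toℕ i) = refl

cycle-sides : {E : BipEdges nX nY} ((f , _) : HasInduced (cycleAdj (suc n)) (bipGraph E)) →
  ∀ i → isInj₁ (f i) ≡ odd (toℕ i) xor isInj₁ (f zero)
cycle-sides (f , _ , f-adj) = alternation (isInj₁ ∘ f) λ i →
  bipGraph-edge-flips (trans (f-adj (inject₁ i) (suc i) (inject₁≢suc i)) (cycleAdj-step i))

-- The edges of C_{2k} from the vertices 2t + b to the vertices 2t′ + (1 − b).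
cycleCross : ∀ k → Fin 2 → BipEdges k k
cycleCross k b t t′ = cycleAdj (k * 2) (combine t b) (combine t′ (opposite b))

cycle⇒cycleCross⊑ : ∀ {k} {E : BipEdges nX nY} → HasInduced (cycleAdj (suc k * 2)) (bipGraph E) →
  ∃[ b ] cycleCross (suc k) b ⊑ E
cycle⇒cycleCross⊑ {E = E} C@(f , _) =
  b , ⊑-of-embedding {G = bipGraph E} C (λ t → combine t b) (λ t → combine t (opposite b))
        (λ t → isInj₁-true (trans (side t b) (b-in-X c₀)))
        (λ t → isInj₁-false (trans (side t (opposite b)) (b-in-Y c₀)))
  where
  c₀ : Bool
  c₀ = isInj₁ (f zero)
  b : Fin 2
  b = if c₀ then 0F else 1F
  side : ∀ t b′ → isInj₁ (f (combine t b′)) ≡ odd (toℕ b′) xor c₀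
  side t b′ = trans (cycle-sides C (combine t b′)) (cong (_xor c₀) (odd-combine t b′))
  b-in-X : ∀ c → odd (toℕ (if c then 0F else 1F)) xor c ≡ true
  b-in-X true  = refl
  b-in-X false = refl
  b-in-Y : ∀ c → odd (toℕ (opposite (if c then 0F else 1F))) xor c ≡ false
  b-in-Y true  = refl
  b-in-Y false = refl

cycleMatrix₃⊑cycleCross : ∀ b → cycleMatrix 3 ⊑ cycleCross 3 b
cycleMatrix₃⊑cycleCross 0F = ⊑-via id id
cycleMatrix₃⊑cycleCross 1F = ⊑-via id (lookup (1F ∷ 2F ∷ 0F ∷ []))

cycleMatrix₄⊑cycleCross : ∀ b → cycleMatrix 4 ⊑ cycleCross 4 b
cycleMatrix₄⊑cycleCross 0F = ⊑-via id id
cycleMatrix₄⊑cycleCross 1F = ⊑-via id (lookup (1F ∷ 2F ∷ 3F ∷ 0F ∷ []))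

C₆⇒cycleMatrix⊑ : {E : BipEdges nX nY} → HasInduced (cycleAdj 6) (bipGraph E) → cycleMatrix 3 ⊑ E
C₆⇒cycleMatrix⊑ C = let b , X = cycle⇒cycleCross⊑ C in ⊑-trans (cycleMatrix₃⊑cycleCross b) X

C₈⇒cycleMatrix⊑ : {E : BipEdges nX nY} → HasInduced (cycleAdj 8) (bipGraph E) → cycleMatrix 4 ⊑ E
C₈⇒cycleMatrix⊑ C = let b , X = cycle⇒cycleCross⊑ C in ⊑-trans (cycleMatrix₄⊑cycleCross b) X

cycleMatrix⊑⇒C₆ : {E : BipEdges nX nY} → cycleMatrix 3 ⊑ E → HasInduced (cycleAdj 6) (bipGraph E)
cycleMatrix⊑⇒C₆ {E = E} M = HasInduced-trans {G = bipGraph E}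
  (induced-via (≡-dec _≟ᶠ_ _≟ᶠ_) (cycleAdj 6) (bipGraph (cycleMatrix 3)) zigzag) (bipGraph-⊑ M)

cycleMatrix⊑⇒C₈ : {E : BipEdges nX nY} → cycleMatrix 4 ⊑ E → HasInduced (cycleAdj 8) (bipGraph E)
cycleMatrix⊑⇒C₈ {E = E} M = HasInduced-trans {G = bipGraph E}
  (induced-via (≡-dec _≟ᶠ_ _≟ᶠ_) (cycleAdj 8) (bipGraph (cycleMatrix 4)) zigzag) (bipGraph-⊑ M)

3K₂-in-long-cycle : 9 ≤ n → HasInduced threeK2 (cycleAdj n)
3K₂-in-long-cycle 9≤n with m≤n⇒∃[o]m+o≡n 9≤n
... | m , refl = induced-via _≟ᶠ_ threeK2 (cycleAdj (9 + m))
  (lookup (0F ∷ 1F ∷ 3F ∷ 4F ∷ 6F ∷ 7F ∷ []))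

-- Split graphs

module _ {E : BipEdges nX nY} where

  -- Any five consecutive vertices of a chordless cycle of length at least 4 form such a walk
  -- (with v₄ = v₀ for length 4).
  splitX-no-chordless-walk : ∀ v₀ v₁ v₂ v₃ v₄ →
    splitX E v₀ v₁ ≡ true → splitX E v₁ v₂ ≡ true →
    splitX E v₂ v₃ ≡ true → splitX E v₃ v₄ ≡ true →
    splitX E v₀ v₂ ≡ false → splitX E v₁ v₃ ≡ false → splitX E v₂ v₄ ≡ false → ⊥
  splitX-no-chordless-walk _ (inj₁ _) _ (inj₁ _) _ _ _ _ _ _ () _
  splitX-no-chordless-walk (inj₁ _) _ (inj₁ _) _ _ _ _ _ _ () _ _
  splitX-no-chordless-walk _ _ (inj₁ _) _ (inj₁ _) _ _ _ _ _ _ ()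
  splitX-no-chordless-walk (inj₂ _) (inj₂ _) _ _ _ () _ _ _ _ _ _
  splitX-no-chordless-walk _ (inj₂ _) (inj₂ _) _ _ _ () _ _ _ _ _
  splitX-no-chordless-walk _ _ (inj₂ _) (inj₂ _) _ _ _ () _ _ _ _
  splitX-no-chordless-walk _ _ _ (inj₂ _) (inj₂ _) _ _ _ () _ _ _

  splitX-chordal : Chordal (splitX E)
  splitX-chordal _ (s≤s (s≤s (s≤s (s≤s (z≤n {zero}))))) (f , _ , f-adj) =
    splitX-no-chordless-walk (f 0F) (f 1F) (f 2F) (f 3F) (f 0F)
      (f-adj 0F 1F (λ ())) (f-adj 1F 2F (λ ())) (f-adj 2F 3F (λ ())) (f-adj 3F 0F (λ ()))
      (f-adj 0F 2F (λ ())) (f-adj 1F 3F (λ ())) (f-adj 2F 0F (λ ()))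
  splitX-chordal _ (s≤s (s≤s (s≤s (s≤s (z≤n {suc _}))))) (f , _ , f-adj) =
    splitX-no-chordless-walk (f 0F) (f 1F) (f 2F) (f 3F) (f 4F)
      (f-adj 0F 1F (λ ())) (f-adj 1F 2F (λ ())) (f-adj 2F 3F (λ ())) (f-adj 3F 4F (λ ()))
      (f-adj 0F 2F (λ ())) (f-adj 1F 3F (λ ())) (f-adj 2F 4F (λ ()))

  splitX-nonneighbour-in-Y : ∀ u v w →
    splitX E u v ≡ false → splitX E v w ≡ true → splitX E u w ≡ false → IsInj₂ u
  splitX-nonneighbour-in-Y (inj₂ y) _ _ _ _ _ = y , refl
  splitX-nonneighbour-in-Y (inj₁ _) (inj₁ _) _ () _ _
  splitX-nonneighbour-in-Y (inj₁ _) (inj₂ _) (inj₁ _) _ _ ()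
  splitX-nonneighbour-in-Y (inj₁ _) (inj₂ _) (inj₂ _) _ () _

  splitX-neighbour-in-X : ∀ u v → splitX E u v ≡ true → IsInj₂ u → IsInj₁ v
  splitX-neighbour-in-X _ (inj₁ x) _ _ = x , refl
  splitX-neighbour-in-X (inj₂ _) (inj₂ _) () _
  splitX-neighbour-in-X (inj₁ _) (inj₂ _) _ (_ , ())

  complement-splitX⇒splitX : HasInduced (complement (splitX E)) (splitX (mirrorᵀ E))
  complement-splitX⇒splitX = swap , swap-injective , λ u v _ → adjacency u v
    where
    adjacency : ∀ u v → splitX (mirrorᵀ E) (swap u) (swap v) ≡ complement (splitX E) u v
    adjacency (inj₁ _) (inj₁ _) = refl
    adjacency (inj₁ _) (inj₂ _) = refl
    adjacency (inj₂ _) (inj₁ _) = refl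
    adjacency (inj₂ _) (inj₂ _) = refl

  splitX⇒complement-splitX : HasInduced (splitX (mirrorᵀ E)) (complement (splitX E))
  splitX⇒complement-splitX = swap , swap-injective , λ u v _ → adjacency u v
    where
    adjacency : ∀ u v → complement (splitX E) (swap u) (swap v) ≡ splitX (mirrorᵀ E) u v
    adjacency (inj₁ _) (inj₁ _) = refl
    adjacency (inj₁ _) (inj₂ _) = refl
    adjacency (inj₂ _) (inj₁ _) = refl
    adjacency (inj₂ _) (inj₂ _) = refl

-- Suns

sunAdj-spoke : ∀ {k} (i : Fin k) → sunAdj k (inj₂ i) (inj₁ i) ≡ true
sunAdj-spoke i rewrite ≡ᵇ-refl (toℕ i) = refl

sunAdj-previous : ∀ {m} (a : Fin (2 + m)) →
  sunAdj (3 + m) (inj₂ (suc a)) (inj₁ (inject₁ a)) ≡ false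
sunAdj-previous zero    = refl
sunAdj-previous (suc a) rewrite toℕ-inject₁ a | 1+n≢ᵇn (toℕ a) | 2+n≢ᵇn (toℕ a) = refl

-- s_{a−1} ~ q_{a−1} ≁ s_a, and for a = 0: s₁ ~ q₂ ≁ s₀.
sun-witness : ∀ {k} → 3 ≤ k → (a : Fin k) → ∃[ b ] ∃[ c ]
  a ≢ b × sunAdj k (inj₂ b) (inj₁ c) ≡ true × sunAdj k (inj₂ a) (inj₁ c) ≡ false
sun-witness (s≤s (s≤s (s≤s z≤n))) zero    = 1F , 2F , (λ ()) , refl , refl
sun-witness (s≤s (s≤s (s≤s z≤n))) (suc a) =
  inject₁ a , inject₁ a , ≢-sym (inject₁≢suc a) , sunAdj-spoke (inject₁ a) , sunAdj-previous a

-- No stable vertex s_a lies in the clique X: the witness s_b is not adjacent to s_a, so it lies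
-- in Y, so its neighbour q_c lies in X and would be adjacent to s_a.  Then each q_i lies in X,
-- being adjacent to s_i.
sun⇒cycleMatrix⊑ : ∀ {k} {E : BipEdges nX nY} →
  3 ≤ k → HasInduced (sunAdj k) (splitX E) → cycleMatrix k ⊑ E
sun⇒cycleMatrix⊑ {E = E} 3≤k S@(f , _ , f-adj) =
  ⊑-of-embedding {G = splitX E} S inj₁ inj₂ clique-in-X stable-in-Y
  where
  stable-in-Y : ∀ a → IsInj₂ (f (inj₂ a))
  stable-in-Y a with sun-witness 3≤k a
  ... | b , c , a≢b , b~c , a≁c = splitX-nonneighbour-in-Y (f (inj₂ a)) (f (inj₂ b)) (f (inj₁ c))
    (f-adj (inj₂ a) (inj₂ b) (a≢b ∘ inj₂-injective))
    (trans (f-adj (inj₂ b) (inj₁ c) (λ ())) b~c)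
    (trans (f-adj (inj₂ a) (inj₁ c) (λ ())) a≁c)
  clique-in-X : ∀ i → IsInj₁ (f (inj₁ i))
  clique-in-X i = splitX-neighbour-in-X (f (inj₂ i)) (f (inj₁ i))
    (trans (f-adj (inj₂ i) (inj₁ i) (λ ())) (sunAdj-spoke i)) (stable-in-Y i)

sun-as-splitX : ∀ {k} → HasInduced (sunAdj k) (splitX (cycleMatrix k))
sun-as-splitX {k} = id , id , λ u v _ → adjacency u v
  where
  adjacency : ∀ u v → splitX (cycleMatrix k) u v ≡ sunAdj k u v
  adjacency (inj₁ _) (inj₁ _) = refl
  adjacency (inj₁ _) (inj₂ _) = refl
  adjacency (inj₂ _) (inj₁ _) = refl
  adjacency (inj₂ _) (inj₂ _) = refl

cycleMatrix⊑⇒sun : ∀ {k} {E : BipEdges nX nY} → (M : cycleMatrix k ⊑ E) →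
  {checked : True (twinFree? (cycleMatrix k))} → HasInduced (sunAdj k) (splitX E)
cycleMatrix⊑⇒sun {E = E} M {checked} =
  HasInduced-trans {G = splitX E} sun-as-splitX (splitX-⊑ M {checked})

3K₂C₆C₈-free : BipEdges nX nY → Set
3K₂C₆C₈-free E = ¬ HasInduced threeK2 (bipGraph E) ×
  ¬ HasInduced (cycleAdj 6) (bipGraph E) × ¬ HasInduced (cycleAdj 8) (bipGraph E)

long-cycle⇒3K₂ : {G : Adj V} (m : ℕ) → HasInduced (cycleAdj (2 * (5 + m))) G → HasInduced threeK2 G
long-cycle⇒3K₂ {G = G} m = HasInduced-trans {G = G}
  (3K₂-in-long-cycle (≤-trans (n≤1+n 9) (*-monoʳ-≤ 2 (m≤m+n 5 m))))

module _ {E : BipEdges nX nY} where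

  mirror-C₆-free⇒3K₂-free :
    ¬ HasInduced (cycleAdj 6) (bipGraph (mirror E)) → ¬ HasInduced threeK2 (bipGraph E)
  mirror-C₆-free⇒3K₂-free no-C₆ =
    no-C₆ ∘ cycleMatrix⊑⇒C₆ ∘ ⊑-trans cycleMatrix₃⊑mirror-matching ∘ ⊑-mirror ∘ 3K₂⇒matching⊑

  ACB⇒3K₂C₆C₈-free : ACB E → 3K₂C₆C₈-free E
  ACB⇒3K₂C₆C₈-free (chordal , mirror-chordal) =
    mirror-C₆-free⇒3K₂-free (mirror-chordal 3 ≤-refl) , chordal 3 ≤-refl , chordal 4 (n≤1+n 3)

  3K₂C₆C₈-free⇒ACB : 3K₂C₆C₈-free E → ACB E
  3K₂C₆C₈-free⇒ACB (no-3K₂ , no-C₆ , no-C₈) = chordal , mirror-chordal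
    where
    chordal : ChordalBipartite E
    chordal _ (s≤s (s≤s (s≤s (z≤n {0}))))           = no-C₆
    chordal _ (s≤s (s≤s (s≤s (z≤n {1}))))           = no-C₈
    chordal _ (s≤s (s≤s (s≤s (z≤n {suc (suc m)})))) = no-3K₂ ∘ long-cycle⇒3K₂ {G = bipGraph E} m
    mirror-chordal : ChordalBipartite (mirror E)
    mirror-chordal _ (s≤s (s≤s (s≤s (z≤n {0})))) =
      no-3K₂ ∘ matching⊑⇒3K₂ ∘ ⊑-trans matching⊑mirror-cycleMatrix₃ ∘ ⊑-of-mirror
        ∘ C₆⇒cycleMatrix⊑
    mirror-chordal _ (s≤s (s≤s (s≤s (z≤n {1})))) =
      no-C₈ ∘ cycleMatrix⊑⇒C₈ ∘ ⊑-trans cycleMatrix₄⊑mirror-cycleMatrix₄ ∘ ⊑-of-mirror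
        ∘ C₈⇒cycleMatrix⊑
    mirror-chordal _ (s≤s (s≤s (s≤s (z≤n {suc (suc m)})))) =
      no-C₆ ∘ cycleMatrix⊑⇒C₆ ∘ ⊑-trans cycleMatrix₃⊑mirror-matching ∘ ⊑-of-mirror ∘ 3K₂⇒matching⊑
        ∘ long-cycle⇒3K₂ {G = bipGraph (mirror E)} m

  3K₂C₆C₈-free⇒split-strongly-chordal : 3K₂C₆C₈-free E →
    StronglyChordal (splitX E) × StronglyChordal (complement (splitX E))
  3K₂C₆C₈-free⇒split-strongly-chordal (no-3K₂ , no-C₆ , no-C₈) =
    (splitX-chordal , no-sun) ,
    ((λ k 4≤k → splitX-chordal k 4≤k ∘ via-mirrorᵀ) , λ k 3≤k → no-co-sun k 3≤k ∘ via-mirrorᵀ)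
    where
    via-mirrorᵀ : ∀ {W} {H : Adj W} →
      HasInduced H (complement (splitX E)) → HasInduced H (splitX (mirrorᵀ E))
    via-mirrorᵀ C = HasInduced-trans {G = splitX (mirrorᵀ E)} C complement-splitX⇒splitX
    no-sun : ∀ k → 3 ≤ k → ¬ HasInduced (sunAdj k) (splitX E)
    no-sun _ 3≤k@(s≤s (s≤s (s≤s (z≤n {0})))) =
      no-C₆ ∘ cycleMatrix⊑⇒C₆ ∘ sun⇒cycleMatrix⊑ 3≤k
    no-sun _ 3≤k@(s≤s (s≤s (s≤s (z≤n {1})))) =
      no-C₈ ∘ cycleMatrix⊑⇒C₈ ∘ sun⇒cycleMatrix⊑ 3≤k
    no-sun _ 3≤k@(s≤s (s≤s (s≤s (z≤n {suc (suc m)})))) =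
      no-3K₂ ∘ matching⊑⇒3K₂ ∘ ⊑-trans (matching⊑cycleMatrix m) ∘ sun⇒cycleMatrix⊑ 3≤k
    no-co-sun : ∀ k → 3 ≤ k → ¬ HasInduced (sunAdj k) (splitX (mirrorᵀ E))
    no-co-sun _ 3≤k@(s≤s (s≤s (s≤s (z≤n {0})))) =
      no-3K₂ ∘ matching⊑⇒3K₂ ∘ ⊑-trans matching⊑mirrorᵀ-cycleMatrix₃ ∘ ⊑-of-mirrorᵀ
        ∘ sun⇒cycleMatrix⊑ 3≤k
    no-co-sun _ 3≤k@(s≤s (s≤s (s≤s (z≤n {1})))) =
      no-C₈ ∘ cycleMatrix⊑⇒C₈ ∘ ⊑-trans cycleMatrix₄⊑mirrorᵀ-cycleMatrix₄ ∘ ⊑-of-mirrorᵀ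
        ∘ sun⇒cycleMatrix⊑ 3≤k
    no-co-sun _ 3≤k@(s≤s (s≤s (s≤s (z≤n {suc (suc m)})))) =
      no-C₆ ∘ cycleMatrix⊑⇒C₆ ∘ ⊑-trans cycleMatrix₃⊑mirrorᵀ-matching ∘ ⊑-of-mirrorᵀ
        ∘ ⊑-trans (matching⊑cycleMatrix m) ∘ sun⇒cycleMatrix⊑ 3≤k

  split-strongly-chordal⇒3K₂C₆C₈-free :
    StronglyChordal (splitX E) × StronglyChordal (complement (splitX E)) → 3K₂C₆C₈-free E
  split-strongly-chordal⇒3K₂C₆C₈-free ((_ , no-sun) , (_ , no-co-sun)) =
    (λ K → no-co-sun 3 ≤-refl (HasInduced-trans {G = complement (splitX E)}
      (cycleMatrix⊑⇒sun (⊑-trans cycleMatrix₃⊑mirrorᵀ-matching (⊑-mirrorᵀ (3K₂⇒matching⊑ K))))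
      splitX⇒complement-splitX)) ,
    (λ C → no-sun 3 ≤-refl (cycleMatrix⊑⇒sun (C₆⇒cycleMatrix⊑ C))) ,
    (λ C → no-sun 4 (n≤1+n 3) (cycleMatrix⊑⇒sun (C₈⇒cycleMatrix⊑ C)))

corollary2 : {nX nY : ℕ} (E : BipEdges nX nY) →
    let iACB = ACB E
        ii = ¬ HasInduced threeK2 (bipGraph E) × ¬ HasInduced (cycleAdj 6) (bipGraph E) × ¬ HasInduced (cycleAdj 8) (bipGraph E)
        iii = ChordalBipartite E × ¬ HasInduced threeK2 (bipGraph E)
        iv = StronglyChordal (splitX E) × StronglyChordal (complement (splitX E))
    in (iACB ⇔ ii) × (iACB ⇔ iii) × (iACB ⇔ iv)
corollary2 E =
  mk⇔ ACB⇒3K₂C₆C₈-free 3K₂C₆C₈-free⇒ACB ,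
  mk⇔ (λ acb → proj₁ acb , proj₁ (ACB⇒3K₂C₆C₈-free acb))
      (λ (chordal , no-3K₂) → 3K₂C₆C₈-free⇒ACB (no-3K₂ , chordal 3 ≤-refl , chordal 4 (n≤1+n 3))) ,
  mk⇔ (3K₂C₆C₈-free⇒split-strongly-chordal ∘ ACB⇒3K₂C₆C₈-free)
      (3K₂C₆C₈-free⇒ACB ∘ split-strongly-chordal⇒3K₂C₆C₈-free)
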